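{- Let $r$ be a complex number and $n\ge0$ an integer. Then, as polynomials in $x$, $$D_n^{(r)}(x)=x^n-\sum_{k=1}^{n-1}k(k+2r)D_{k-1}^{(r)}(x)\,x^{n-1-k}$$ and $$n!\,d_n^{(r)}(x)=(1+2x)^n+\sum_{k=1}^{n-1}(k+2r)\,k!\,d_{k-1}^{(r)}(x)(1+2x)^{n-1-k}.$$
   Context: For a complex number $a$ and integer $k\ge0$, $\binom{a}{k}=a(a-1)\cdots(a-k+1)/k!$. For a parameter $r$ and an integer $n\ge 0$, $d_n^{(r)}(x)=\sum_{k=0}^n\binom{x+r+k}{k}\binom{x-r}{n-k}$. The polynomials $D_n^{(r)}(x)$ are defined by $D_{ -1}^{(r)}(x)=0$, $D_0^{(r)}(x)=1$ and $D_{n+1}^{(r)}(x)=xD_n^{(r)}(x)-n(n+2r)D_{n-1}^{(r)}(x)$ for $n\ge0$. -}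

module Defs where

open import Level using (Level)
open import Data.Nat using (ℕ; zero; suc; _∸_; _!)

open import Algebra.Bundles using (CommutativeRing)

-- Everything is defined over an arbitrary commutative ring R together with
-- a function  inv  which (by hypothesis in the theorem) gives inv n = 1/(n+1).
module Ops {c ℓ : Level} (R : CommutativeRing c ℓ) (inv : ℕ → CommutativeRing.Carrier R) where
  open CommutativeRing R

  _−_ : Carrier → Carrier → Carrier
  a − b = a + (- b)
  infixl 6 _−_

  ι : ℕ → Carrier
  ι zero = 0#
  ι (suc n) = 1# + ι n

  pow : Carrier → ℕ → Carrier
  pow a zero = 1#
  pow a (suc n) = a * pow a n

  sumTo : ℕ → (ℕ → Carrier) → Carrier
  sumTo zero f = 0#
  sumTo (suc n) f = sumTo n f + f n

  falling : Carrier → ℕ → Carrier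
  falling a zero = 1#
  falling a (suc k) = falling a k * (a − ι k)

  invFact : ℕ → Carrier
  invFact zero = 1#
  invFact (suc k) = invFact k * inv k

  binom : Carrier → ℕ → Carrier
  binom a k = falling a k * invFact k

  d : Carrier → ℕ → Carrier → Carrier
  d r n x = sumTo (suc n) (λ k → binom (x + r + ι k) k * binom (x − r) (n ∸ k))

  D : Carrier → ℕ → Carrier → Carrier
  D r zero x = 1#
  D r (suc zero) x = x
  D r (suc (suc n)) x = x * D r (suc n) x − ι (suc n) * (ι (suc n) + (r + r)) * D r n x

  fact : ℕ → Carrier
  fact n = ι (n !)

{-# OPTIONS --safe #-}
module Submission where

-- Both identities unfold a recurrence u₍ₙ₊₂₎ = y u₍ₙ₊₁₎ + cₙ with u₀ = 1, u₁ = y.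
-- For Dₙ this is its definition with y = x.  For n! dₙ, write dₙ = Σ_{k+m=n} aₖ bₘ with
-- aₖ = binom(x+r+k, k), bₘ = binom(x−r, m), which satisfy (k+1) aₖ₊₁ = (x+r+k+1) aₖ and
-- (m+1) bₘ₊₁ = (x−r−m) bₘ.  Weighting the terms of this product by k ± m and lowering the
-- indices gives (n+1) dₙ₊₁ = (1+2x) dₙ + Σ_{k+m=n} (k−m) aₖ bₘ and Σ_{k+m=n+1} (k−m) aₖ bₘ = (n+1+2r) dₙ,
-- hence (n+2) dₙ₊₂ = (1+2x) dₙ₊₁ + (n+1+2r) dₙ, which becomes the recurrence for uₙ = n! dₙ.

open import Defs
open import Level using (Level)
open import Data.Nat using (ℕ; suc; _∸_)
open import Data.Product using (_×_)
open import Algebra.Bundles using (CommutativeRing)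
open import Algebra.Bundles using (RawRing)
open import Data.Maybe using (Maybe; nothing; just)
open import Data.Nat as ℕ using (zero; _≤_; _<_; s≤s)
import Data.Nat.Properties as ℕ
open import Data.Product using (_,_)
import Data.Product.Properties as Product
open import Relation.Binary.PropositionalEquality as ≡ using (_≡_)
open import Relation.Nullary using (yes; no)
open import Algebra.Solver.Ring.AlmostCommutativeRing
  using (fromCommutativeRing; _-Raw-AlmostCommutative⟶_)
import Algebra.Solver.Ring as RingSolver
import Algebra.Properties.Ring as RingProperties
import Algebra.Properties.AbelianGroup as AbelianGroupProperties
import Algebra.Properties.CommutativeSemigroup as CommutativeSemigroupProperties
import Relation.Binary.Reasoning.Setoid as SetoidReasoning

module Proof {c ℓ : Level} (R : CommutativeRing c ℓ) (inv : ℕ → CommutativeRing.Carrier R) where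
  open CommutativeRing R
  open Ops R inv
  open RingProperties ring using (-‿distribˡ-*; -‿distribʳ-*; -‿involutive; -0#≈0#)
  open AbelianGroupProperties +-abelianGroup using (⁻¹-∙-comm)
  open CommutativeSemigroupProperties *-commutativeSemigroup using (x∙yz≈y∙xz)
  open CommutativeSemigroupProperties +-commutativeSemigroup using () renaming (interchange to +-interchange)
  open SetoidReasoning setoid

  ι-+ : ∀ m n → ι (m ℕ.+ n) ≈ ι m + ι n
  ι-+ zero n = sym (+-identityˡ _)
  ι-+ (suc m) n = trans (+-congˡ (ι-+ m n)) (sym (+-assoc _ _ _))

  ι-* : ∀ m n → ι (m ℕ.* n) ≈ ι m * ι n
  ι-* zero n = sym (zeroˡ _)
  ι-* (suc m) n = begin
    ι (n ℕ.+ m ℕ.* n)        ≈⟨ ι-+ n (m ℕ.* n) ⟩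
    ι n + ι (m ℕ.* n)        ≈⟨ +-cong (sym (*-identityˡ _)) (ι-* m n) ⟩
    1# * ι n + ι m * ι n     ≈⟨ sym (distribʳ _ _ _) ⟩
    (1# + ι m) * ι n         ∎

  −-+-interchange : ∀ a b c d → (a + c) − (b + d) ≈ (a − b) + (c − d)
  −-+-interchange a b c d = trans (+-congˡ (sym (⁻¹-∙-comm b d))) (+-interchange a c (- b) (- d))

  −-*-expand : ∀ a b c d → (a * c + b * d) − (a * d + b * c) ≈ (a − b) * (c − d)
  −-*-expand a b c d = sym (begin
    (a + - b) * (c + - d)                        ≈⟨ distribʳ _ _ _ ⟩
    a * (c + - d) + - b * (c + - d)              ≈⟨ +-cong (distribˡ _ _ _) (distribˡ _ _ _) ⟩
    (a * c + a * - d) + (- b * c + - b * - d)    ≈⟨ +-cong (+-congˡ (sym (-‿distribʳ-* a d)))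
                                                           (+-cong (sym (-‿distribˡ-* b c)) neg-neg) ⟩
    (a * c + - (a * d)) + (- (b * c) + b * d)    ≈⟨ +-congˡ (+-comm _ _) ⟩
    (a * c + - (a * d)) + (b * d + - (b * c))    ≈⟨ sym (−-+-interchange _ _ _ _) ⟩
    (a * c + b * d) + - (a * d + b * c)          ∎)
    where
    neg-neg : - b * - d ≈ b * d
    neg-neg = trans (sym (-‿distribˡ-* b (- d)))
                    (trans (-‿cong (sym (-‿distribʳ-* b d))) (-‿involutive _))

  ι-∸ : ∀ m n → ι (m ∸ n) − ι (n ∸ m) ≈ ι m − ι n
  ι-∸ zero    zero    = refl
  ι-∸ zero    (suc n) = refl
  ι-∸ (suc m) zero    = refl
  ι-∸ (suc m) (suc n) = begin
    ι (m ∸ n) − ι (n ∸ m)     ≈⟨ ι-∸ m n ⟩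
    ι m − ι n                 ≈⟨ sym (+-identityˡ _) ⟩
    0# + (ι m − ι n)          ≈⟨ +-congʳ (sym (-‿inverseʳ 1#)) ⟩
    (1# − 1#) + (ι m − ι n)   ≈⟨ sym (−-+-interchange 1# 1# (ι m) (ι n)) ⟩
    ι (suc m) − ι (suc n)     ∎

  -- Integer coefficients for the ring solver: a pair (p , n) stands for p − n and is kept in the
  -- normal form where one component is 0, so that equal coefficients are identical.
  normalise : ℕ × ℕ → ℕ × ℕ
  normalise (p , n) = (p ∸ n , n ∸ p)

  ℤ-rawRing : RawRing _ _
  ℤ-rawRing = record
    { Carrier = ℕ × ℕ
    ; _≈_     = _≡_
    ; _+_     = λ { (p , n) (p′ , n′) → normalise (p ℕ.+ p′ , n ℕ.+ n′) }
    ; _*_     = λ { (p , n) (p′ , n′) → normalise (p ℕ.* p′ ℕ.+ n ℕ.* n′ , p ℕ.* n′ ℕ.+ n ℕ.* p′) }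
    ; -_      = λ { (p , n) → (n , p) }
    ; 0#      = (0 , 0)
    ; 1#      = (1 , 0)
    }

  -- 0 and 1 are sent to 0# and 1# on the nose, so that solved equations mention them literally.
  ⟦_⟧ℤ : ℕ × ℕ → Carrier
  ⟦ 0 , 0 ⟧ℤ = 0#
  ⟦ 1 , 0 ⟧ℤ = 1#
  ⟦ p , n ⟧ℤ = ι p − ι n

  ⟦⟧ℤ-≈ : ∀ p n → ⟦ p , n ⟧ℤ ≈ ι p − ι n
  ⟦⟧ℤ-≈ 0             0       = sym (trans (+-congˡ -0#≈0#) (+-identityʳ _))
  ⟦⟧ℤ-≈ 1             0       = sym (trans (+-congˡ -0#≈0#) (trans (+-identityʳ _) (+-identityʳ _)))
  ⟦⟧ℤ-≈ 0             (suc n) = refl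
  ⟦⟧ℤ-≈ 1             (suc n) = refl
  ⟦⟧ℤ-≈ (suc (suc p)) n       = refl

  ⟦normalise⟧ : ∀ p n → ⟦ normalise (p , n) ⟧ℤ ≈ ι p − ι n
  ⟦normalise⟧ p n = trans (⟦⟧ℤ-≈ (p ∸ n) (n ∸ p)) (ι-∸ p n)

  ℤ-homomorphism : ℤ-rawRing -Raw-AlmostCommutative⟶ fromCommutativeRing R
  ℤ-homomorphism = record
    { ⟦_⟧    = ⟦_⟧ℤ
    ; +-homo = λ { (p , n) (p′ , n′) → begin
        ⟦ normalise (p ℕ.+ p′ , n ℕ.+ n′) ⟧ℤ ≈⟨ ⟦normalise⟧ (p ℕ.+ p′) (n ℕ.+ n′) ⟩
        ι (p ℕ.+ p′) − ι (n ℕ.+ n′)          ≈⟨ +-cong (ι-+ p p′) (-‿cong (ι-+ n n′)) ⟩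
        (ι p + ι p′) − (ι n + ι n′)          ≈⟨ −-+-interchange _ _ _ _ ⟩
        (ι p − ι n) + (ι p′ − ι n′)          ≈⟨ +-cong (⟦⟧ℤ-≈ p n) (⟦⟧ℤ-≈ p′ n′) ⟨
        ⟦ p , n ⟧ℤ + ⟦ p′ , n′ ⟧ℤ            ∎ }
    ; *-homo = λ { (p , n) (p′ , n′) → begin
        ⟦ normalise (p ℕ.* p′ ℕ.+ n ℕ.* n′ , p ℕ.* n′ ℕ.+ n ℕ.* p′) ⟧ℤ ≈⟨ ⟦normalise⟧ (p ℕ.* p′ ℕ.+ n ℕ.* n′) (p ℕ.* n′ ℕ.+ n ℕ.* p′) ⟩
        ι (p ℕ.* p′ ℕ.+ n ℕ.* n′) − ι (p ℕ.* n′ ℕ.+ n ℕ.* p′)          ≈⟨ +-cong (ι-+-* p p′ n n′) (-‿cong (ι-+-* p n′ n p′)) ⟩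
        (ι p * ι p′ + ι n * ι n′) − (ι p * ι n′ + ι n * ι p′)          ≈⟨ −-*-expand _ _ _ _ ⟩
        (ι p − ι n) * (ι p′ − ι n′)                                    ≈⟨ *-cong (⟦⟧ℤ-≈ p n) (⟦⟧ℤ-≈ p′ n′) ⟨
        ⟦ p , n ⟧ℤ * ⟦ p′ , n′ ⟧ℤ                                      ∎ }
    ; -‿homo = λ { (p , n) → begin
        ⟦ n , p ⟧ℤ        ≈⟨ ⟦⟧ℤ-≈ n p ⟩
        ι n − ι p         ≈⟨ +-comm _ _ ⟩
        - ι p + ι n       ≈⟨ +-congˡ (sym (-‿involutive _)) ⟩
        - ι p + - - ι n   ≈⟨ ⁻¹-∙-comm _ _ ⟩
        - (ι p − ι n)     ≈⟨ -‿cong (⟦⟧ℤ-≈ p n) ⟨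
        - ⟦ p , n ⟧ℤ      ∎ }
    ; 0-homo = refl
    ; 1-homo = refl
    }
    where
    ι-+-* : ∀ a b c d → ι (a ℕ.* b ℕ.+ c ℕ.* d) ≈ ι a * ι b + ι c * ι d
    ι-+-* a b c d = trans (ι-+ (a ℕ.* b) (c ℕ.* d)) (+-cong (ι-* a b) (ι-* c d))

  ℤ-equal? : ∀ i j → Maybe (⟦ i ⟧ℤ ≈ ⟦ j ⟧ℤ)
  ℤ-equal? i j with Product.≡-dec ℕ._≟_ ℕ._≟_ i j
  ... | yes i≡j = just (reflexive (≡.cong ⟦_⟧ℤ i≡j))
  ... | no  _   = nothing

  open RingSolver ℤ-rawRing (fromCommutativeRing R) ℤ-homomorphism ℤ-equal?
    using (solve; _:=_; _:+_; _:*_; _:-_; con)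


  ① : ∀ {n} → RingSolver.Polynomial ℤ-rawRing (fromCommutativeRing R) ℤ-homomorphism ℤ-equal? n
  ① = con (1 , 0)

  ι-split : ∀ {k n} → k ≤ n → ι n ≈ ι k + ι (n ∸ k)
  ι-split {k} k≤n = trans (reflexive (≡.cong ι (≡.sym (ℕ.m+[n∸m]≡n k≤n)))) (ι-+ k _)

  sumTo-cong : ∀ n {f g : ℕ → Carrier} → (∀ k → k < n → f k ≈ g k) → sumTo n f ≈ sumTo n g
  sumTo-cong zero    f≈g = refl
  sumTo-cong (suc n) f≈g = +-cong (sumTo-cong n (λ k k<n → f≈g k (ℕ.m<n⇒m<1+n k<n))) (f≈g n ℕ.≤-refl)

  sumTo-head : ∀ n (f : ℕ → Carrier) → sumTo (suc n) f ≈ f 0 + sumTo n (λ k → f (suc k))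
  sumTo-head zero    f = trans (+-identityˡ _) (sym (+-identityʳ _))
  sumTo-head (suc n) f = trans (+-congʳ (sumTo-head n f)) (+-assoc _ _ _)

  sumTo-distrib-+ : ∀ n (f g : ℕ → Carrier) → sumTo n (λ k → f k + g k) ≈ sumTo n f + sumTo n g
  sumTo-distrib-+ zero    f g = sym (+-identityʳ _)
  sumTo-distrib-+ (suc n) f g = trans (+-congʳ (sumTo-distrib-+ n f g))
    (solve 4 (λ a b c d → (a :+ b) :+ (c :+ d) := (a :+ c) :+ (b :+ d)) refl _ _ _ _)

  *-distribˡ-sumTo : ∀ n a (f : ℕ → Carrier) → sumTo n (λ k → a * f k) ≈ a * sumTo n f
  *-distribˡ-sumTo zero    a f = sym (zeroʳ _)
  *-distribˡ-sumTo (suc n) a f = trans (+-congʳ (*-distribˡ-sumTo n a f)) (sym (distribˡ _ _ _))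

  -‿distrib-sumTo : ∀ n (f : ℕ → Carrier) → sumTo n (λ k → - f k) ≈ - sumTo n f
  -‿distrib-sumTo zero    f = sym -0#≈0#
  -‿distrib-sumTo (suc n) f = trans (+-congʳ (-‿distrib-sumTo n f)) (⁻¹-∙-comm _ _)

  unfold-recurrence : (y : Carrier) (u c : ℕ → Carrier) → u 0 ≈ 1# → u 1 ≈ y →
                      (∀ n → u (suc (suc n)) ≈ y * u (suc n) + c n) →
                      ∀ n → u n ≈ pow y n + sumTo (n ∸ 1) (λ j → c j * pow y (n ∸ 1 ∸ suc j))
  unfold-recurrence y u c u₀ u₁ uₙ₊₂ zero = trans u₀ (sym (+-identityʳ _))
  unfold-recurrence y u c u₀ u₁ uₙ₊₂ (suc zero) = trans u₁ (sym (trans (+-identityʳ _) (*-identityʳ _)))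
  unfold-recurrence y u c u₀ u₁ uₙ₊₂ (suc (suc n)) = begin
    u (suc (suc n))                                       ≈⟨ uₙ₊₂ n ⟩
    y * u (suc n) + c n                                   ≈⟨ +-congʳ (*-congˡ (unfold-recurrence y u c u₀ u₁ uₙ₊₂ (suc n))) ⟩
    y * (pow y (suc n) + tail n) + c n                    ≈⟨ solve 4 (λ y p s c → y :* (p :+ s) :+ c := y :* p :+ (y :* s :+ c :* ①))
                                                                    refl y (pow y (suc n)) (tail n) (c n) ⟩
    pow y (suc (suc n)) + (y * tail n + c n * 1#)         ≈⟨ +-congˡ (+-cong (sym y*tail) (*-congˡ (reflexive (≡.cong (pow y) (≡.sym (ℕ.n∸n≡0 n)))))) ⟩
    pow y (suc (suc n)) + tail (suc n)                    ∎
    where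
    tail : ℕ → Carrier
    tail m = sumTo m (λ j → c j * pow y (m ∸ suc j))
    y*tail : sumTo n (λ j → c j * pow y (suc n ∸ suc j)) ≈ y * tail n
    y*tail = trans (sumTo-cong n (λ j j<n → begin
        c j * pow y (suc n ∸ suc j)   ≈⟨ *-congˡ (reflexive (≡.cong (pow y) (ℕ.+-∸-assoc 1 j<n))) ⟩
        c j * (y * pow y (n ∸ suc j)) ≈⟨ x∙yz≈y∙xz _ _ _ ⟩
        y * (c j * pow y (n ∸ suc j)) ∎))
      (*-distribˡ-sumTo n y _)

  D-unfold : ∀ r x n → D r n x ≈ pow x n − sumTo (n ∸ 1) (λ j → ι (suc j) * (ι (suc j) + (r + r)) * D r j x * pow x (n ∸ 1 ∸ suc j))
  D-unfold r x n = begin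
    D r n x                                        ≈⟨ unfold-recurrence x (λ m → D r m x) (λ j → - coeff j) refl refl (λ _ → refl) n ⟩
    pow x n + sumTo (n ∸ 1) (λ j → - coeff j * _)  ≈⟨ +-congˡ (sumTo-cong (n ∸ 1) (λ j _ → sym (-‿distribˡ-* _ _))) ⟩
    pow x n + sumTo (n ∸ 1) (λ j → - (coeff j * _)) ≈⟨ +-congˡ (-‿distrib-sumTo (n ∸ 1) _) ⟩
    pow x n − sumTo (n ∸ 1) (λ j → coeff j * pow x (n ∸ 1 ∸ suc j)) ∎
    where
    coeff : ℕ → Carrier
    coeff j = ι (suc j) * (ι (suc j) + (r + r)) * D r j x

  falling-cong : ∀ {a b} k → a ≈ b → falling a k ≈ falling b k
  falling-cong zero    a≈b = refl
  falling-cong (suc k) a≈b = *-cong (falling-cong k a≈b) (+-congʳ a≈b)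

  falling-suc-suc : ∀ a k → falling (a + 1#) (suc k) ≈ (a + 1#) * falling a k
  falling-suc-suc a zero = solve 1 (λ a → ① :* ((a :+ ①) :- con (0 , 0)) := (a :+ ①) :* ①) refl a
  falling-suc-suc a (suc k) = begin
    falling (a + 1#) (suc k) * ((a + 1#) − (1# + ι k)) ≈⟨ *-congʳ (falling-suc-suc a k) ⟩
    (a + 1#) * falling a k * ((a + 1#) − (1# + ι k))   ≈⟨ solve 3 (λ a f i → (a :+ ①) :* f :* ((a :+ ①) :- (① :+ i)) := (a :+ ①) :* (f :* (a :- i)))
                                                                refl a (falling a k) (ι k) ⟩
    (a + 1#) * (falling a k * (a − ι k))               ∎

  module Convolution (A B : ℕ → Carrier) where

    conv : ℕ → (ℕ → ℕ → Carrier) → Carrier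
    conv n W = sumTo (suc n) (λ k → W k (n ∸ k) * (A k * B (n ∸ k)))

    cauchy : ℕ → Carrier
    cauchy n = sumTo (suc n) (λ k → A k * B (n ∸ k))

    conv-cong : ∀ n (V W : ℕ → ℕ → Carrier) → (∀ k → k ≤ n → V k (n ∸ k) ≈ W k (n ∸ k)) → conv n V ≈ conv n W
    conv-cong n V W V≈W = sumTo-cong (suc n) (λ { k (s≤s k≤n) → *-congʳ (V≈W k k≤n) })

    conv-+ : ∀ n (V W : ℕ → ℕ → Carrier) → conv n (λ k m → V k m + W k m) ≈ conv n V + conv n W
    conv-+ n V W = trans (sumTo-cong (suc n) (λ k _ → distribʳ _ _ _)) (sumTo-distrib-+ (suc n) _ _)

    conv-− : ∀ n (V W : ℕ → ℕ → Carrier) → conv n (λ k m → V k m − W k m) ≈ conv n V − conv n W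
    conv-− n V W = begin
      conv n (λ k m → V k m − W k m)                                   ≈⟨ sumTo-cong (suc n) (λ k _ → solve 3 (λ v w p → (v :- w) :* p := v :* p :- w :* p) refl _ _ _) ⟩
      sumTo (suc n) (λ k → V k (n ∸ k) * _ − W k (n ∸ k) * _)          ≈⟨ sumTo-distrib-+ (suc n) _ _ ⟩
      conv n V + sumTo (suc n) (λ k → - (W k (n ∸ k) * _))             ≈⟨ +-congˡ (-‿distrib-sumTo (suc n) _) ⟩
      conv n V − conv n W                                              ∎

    conv-const : ∀ n a → conv n (λ _ _ → a) ≈ a * cauchy n
    conv-const n a = *-distribˡ-sumTo (suc n) a _

    conv-lowerˡ : ∀ {α : ℕ → Carrier} → (∀ k → ι (suc k) * A (suc k) ≈ α k * A k) →
                  ∀ n → conv (suc n) (λ k _ → ι k) ≈ conv n (λ k _ → α k)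
    conv-lowerˡ {α} lower n = begin
      conv (suc n) (λ k _ → ι k)                                       ≈⟨ sumTo-head (suc n) _ ⟩
      0# * _ + sumTo (suc n) (λ k → ι (suc k) * (A (suc k) * B (n ∸ k))) ≈⟨ +-cong (zeroˡ _) (sumTo-cong (suc n) (λ k _ → shift k)) ⟩
      0# + conv n (λ k _ → α k)                                        ≈⟨ +-identityˡ _ ⟩
      conv n (λ k _ → α k)                                             ∎
      where
      shift : ∀ k → ι (suc k) * (A (suc k) * B (n ∸ k)) ≈ α k * (A k * B (n ∸ k))
      shift k = trans (sym (*-assoc _ _ _)) (trans (*-congʳ (lower k)) (*-assoc _ _ _))

    conv-lowerʳ : ∀ {β : ℕ → Carrier} → (∀ m → ι (suc m) * B (suc m) ≈ β m * B m) →
                  ∀ n → conv (suc n) (λ _ m → ι m) ≈ conv n (λ _ m → β m)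
    conv-lowerʳ {β} lower n = begin
      conv (suc n) (λ _ m → ι m)                        ≈⟨ +-cong (sumTo-cong (suc n) (λ { k (s≤s k≤n) → shift k (ℕ.+-∸-assoc 1 k≤n) })) last-term ⟩
      conv n (λ _ m → β m) + 0#                        ≈⟨ +-identityʳ _ ⟩
      conv n (λ _ m → β m)                             ∎
      where
      shift : ∀ k {m′ m} → m′ ≡ suc m → ι m′ * (A k * B m′) ≈ β m * (A k * B m)
      shift k {m = m} ≡.refl = begin
        ι (suc m) * (A k * B (suc m))  ≈⟨ x∙yz≈y∙xz _ _ _ ⟩
        A k * (ι (suc m) * B (suc m))  ≈⟨ *-congˡ (lower m) ⟩
        A k * (β m * B m)              ≈⟨ x∙yz≈y∙xz _ _ _ ⟩
        β m * (A k * B m)              ∎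
      last-term : ι (suc n ∸ suc n) * (A (suc n) * B (suc n ∸ suc n)) ≈ 0#
      last-term = trans (*-congʳ (reflexive (≡.cong ι (ℕ.n∸n≡0 n)))) (zeroˡ _)

  module _ (ι-suc-*-inv : ∀ m → ι (suc m) * inv m ≈ 1#) where

    ι-suc-*-binom-suc : ∀ a k → ι (suc k) * binom a (suc k) ≈ falling a (suc k) * invFact k
    ι-suc-*-binom-suc a k = begin
      ι (suc k) * (falling a (suc k) * (invFact k * inv k)) ≈⟨ solve 4 (λ s f i v → s :* (f :* (i :* v)) := (f :* i) :* (s :* v)) refl _ _ _ _ ⟩
      (falling a (suc k) * invFact k) * (ι (suc k) * inv k) ≈⟨ *-congˡ (ι-suc-*-inv k) ⟩
      (falling a (suc k) * invFact k) * 1#                  ≈⟨ *-identityʳ _ ⟩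
      falling a (suc k) * invFact k                         ∎

    binom-absorb : ∀ a k → ι (suc k) * binom a (suc k) ≈ (a − ι k) * binom a k
    binom-absorb a k = trans (ι-suc-*-binom-suc a k)
      (solve 4 (λ f a i v → f :* (a :- i) :* v := (a :- i) :* (f :* v)) refl (falling a k) a (ι k) (invFact k))

    binom-suc-suc : ∀ a k → ι (suc k) * binom (a + 1#) (suc k) ≈ (a + 1#) * binom a k
    binom-suc-suc a k = trans (ι-suc-*-binom-suc (a + 1#) k) (trans (*-congʳ (falling-suc-suc a k)) (*-assoc _ _ _))

    module _ (r x : Carrier) where
      open Convolution (λ k → binom (x + r + ι k) k) (binom (x − r))

      y : Carrier
      y = 1# + (x + x)

      α β : ℕ → Carrier
      α k = x + r + ι k + 1#
      β m = x − r − ι m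

      upper-lower : ∀ k → ι (suc k) * binom (x + r + ι (suc k)) (suc k) ≈ α k * binom (x + r + ι k) k
      upper-lower k = trans (*-congˡ (*-congʳ (falling-cong (suc k) upper≈))) (binom-suc-suc (x + r + ι k) k)
        where
        upper≈ : x + r + ι (suc k) ≈ x + r + ι k + 1#
        upper≈ = solve 3 (λ x r i → x :+ r :+ (① :+ i) := x :+ r :+ i :+ ①) refl x r (ι k)

      d-step : ∀ n → ι (suc n) * d r (suc n) x ≈ y * d r n x + conv n (λ k m → ι k − ι m)
      d-step n = begin
        ι (suc n) * cauchy (suc n)                                ≈⟨ conv-const (suc n) (ι (suc n)) ⟨
        conv (suc n) (λ _ _ → ι (suc n))                          ≈⟨ conv-cong (suc n) (λ _ _ → ι (suc n)) (λ k m → ι k + ι m) (λ _ k≤n → ι-split k≤n) ⟩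
        conv (suc n) (λ k m → ι k + ι m)                          ≈⟨ conv-+ (suc n) (λ k _ → ι k) (λ _ m → ι m) ⟩
        conv (suc n) (λ k _ → ι k) + conv (suc n) (λ _ m → ι m)   ≈⟨ +-cong (conv-lowerˡ upper-lower n) (conv-lowerʳ (binom-absorb (x − r)) n) ⟩
        conv n (λ k _ → α k) + conv n (λ _ m → β m)               ≈⟨ conv-+ n (λ k _ → α k) (λ _ m → β m) ⟨
        conv n (λ k m → α k + β m)                                ≈⟨ conv-cong n (λ k m → α k + β m) (λ k m → y + (ι k − ι m)) (λ k _ → α+β k (n ∸ k)) ⟩
        conv n (λ k m → y + (ι k − ι m))                          ≈⟨ conv-+ n (λ _ _ → y) (λ k m → ι k − ι m) ⟩
        conv n (λ _ _ → y) + conv n (λ k m → ι k − ι m)           ≈⟨ +-congʳ (conv-const n y) ⟩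
        y * cauchy n + conv n (λ k m → ι k − ι m)                 ∎
        where
        α+β : ∀ k m → α k + β m ≈ y + (ι k − ι m)
        α+β k m = solve 4 (λ x r i j → (x :+ r :+ i :+ ①) :+ (x :- r :- j) := (① :+ (x :+ x)) :+ (i :- j)) refl x r (ι k) (ι m)

      d-skew : ∀ n → conv (suc n) (λ k m → ι k − ι m) ≈ (ι (suc n) + (r + r)) * d r n x
      d-skew n = begin
        conv (suc n) (λ k m → ι k − ι m)                          ≈⟨ conv-− (suc n) (λ k _ → ι k) (λ _ m → ι m) ⟩
        conv (suc n) (λ k _ → ι k) − conv (suc n) (λ _ m → ι m)   ≈⟨ +-cong (conv-lowerˡ upper-lower n) (-‿cong (conv-lowerʳ (binom-absorb (x − r)) n)) ⟩
        conv n (λ k _ → α k) − conv n (λ _ m → β m)               ≈⟨ conv-− n (λ k _ → α k) (λ _ m → β m) ⟨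
        conv n (λ k m → α k − β m)                                ≈⟨ conv-cong n (λ k m → α k − β m) (λ _ _ → ι (suc n) + (r + r)) α−β ⟩
        conv n (λ _ _ → ι (suc n) + (r + r))                      ≈⟨ conv-const n _ ⟩
        (ι (suc n) + (r + r)) * cauchy n                          ∎
        where
        α−β : ∀ k → k ≤ n → α k − β (n ∸ k) ≈ ι (suc n) + (r + r)
        α−β k k≤n = begin
          α k − β (n ∸ k)                   ≈⟨ solve 4 (λ x r i j → (x :+ r :+ i :+ ①) :- (x :- r :- j) := ① :+ (i :+ j) :+ (r :+ r)) refl x r (ι k) _ ⟩
          1# + (ι k + ι (n ∸ k)) + (r + r)  ≈⟨ +-congʳ (+-congˡ (ι-split k≤n)) ⟨
          ι (suc n) + (r + r)               ∎

      d-skew-zero : conv 0 (λ k m → ι k − ι m) ≈ 0#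
      d-skew-zero = solve 1 (λ p → con (0 , 0) :+ (con (0 , 0) :- con (0 , 0)) :* p := con (0 , 0)) refl _

      d-zero : d r 0 x ≈ 1#
      d-zero = solve 0 (con (0 , 0) :+ (① :* ①) :* (① :* ①) := ①) refl

      fact-d-unfold : ∀ n → fact n * d r n x ≈ pow y n + sumTo (n ∸ 1) (λ j → (ι (suc j) + (r + r)) * fact (suc j) * d r j x * pow y (n ∸ 1 ∸ suc j))
      fact-d-unfold = unfold-recurrence y (λ n → fact n * d r n x) (λ j → (ι (suc j) + (r + r)) * fact (suc j) * d r j x) u₀ u₁ uₙ₊₂
        where
        u₀ : fact 0 * d r 0 x ≈ 1#
        u₀ = trans (*-cong (+-identityʳ 1#) d-zero) (*-identityʳ 1#)
        u₁ : fact 1 * d r 1 x ≈ y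
        u₁ = begin
          ι 1 * d r 1 x          ≈⟨ d-step 0 ⟩
          y * d r 0 x + conv 0 (λ k m → ι k − ι m) ≈⟨ +-cong (*-congˡ d-zero) d-skew-zero ⟩
          y * 1# + 0#            ≈⟨ trans (+-identityʳ _) (*-identityʳ y) ⟩
          y                      ∎
        uₙ₊₂ : ∀ n → fact (suc (suc n)) * d r (suc (suc n)) x ≈ y * (fact (suc n) * d r (suc n) x) + (ι (suc n) + (r + r)) * fact (suc n) * d r n x
        uₙ₊₂ n = begin
          ι (suc (suc n) ℕ.* suc n ℕ.!) * d r (suc (suc n)) x                    ≈⟨ *-congʳ (ι-* (suc (suc n)) (suc n ℕ.!)) ⟩
          ι (suc (suc n)) * fact (suc n) * d r (suc (suc n)) x                   ≈⟨ solve 3 (λ s f e → s :* f :* e := f :* (s :* e)) refl _ _ _ ⟩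
          fact (suc n) * (ι (suc (suc n)) * d r (suc (suc n)) x)                 ≈⟨ *-congˡ (trans (d-step (suc n)) (+-congˡ (d-skew n))) ⟩
          fact (suc n) * (y * d r (suc n) x + (ι (suc n) + (r + r)) * d r n x)   ≈⟨ solve 5 (λ f y e b g → f :* (y :* e :+ b :* g) := y :* (f :* e) :+ b :* f :* g) refl _ _ _ _ _ ⟩
          y * (fact (suc n) * d r (suc n) x) + (ι (suc n) + (r + r)) * fact (suc n) * d r n x ∎

theorem3p5 : {c ℓ : Level} (R : CommutativeRing c ℓ) (inv : ℕ → CommutativeRing.Carrier R) →
    let open CommutativeRing R
        open Ops R inv
    in (∀ m → ι (suc m) * inv m ≈ 1#) →
       (r x : Carrier) (n : ℕ) →
       (D r n x ≈ pow x n − sumTo (n ∸ 1) (λ j → ι (suc j) * (ι (suc j) + (r + r)) * D r j x * pow x (n ∸ 1 ∸ suc j)))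
       × (fact n * d r n x ≈ pow (1# + (x + x)) n + sumTo (n ∸ 1) (λ j → (ι (suc j) + (r + r)) * fact (suc j) * d r j x * pow (1# + (x + x)) (n ∸ 1 ∸ suc j)))
theorem3p5 R inv ι-suc-*-inv r x n = Proof.D-unfold R inv r x n , Proof.fact-d-unfold R inv ι-suc-*-inv r x n
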